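{- Let $t_1,t_2,t_3$ be positive integers with $t_1\ge2$, and let $G$ be a graph with no induced subgraph isomorphic to $S_{t_1,t_2,t_3}$. Then $S_{t_1-1,t_2,t_3}+K_1$ is an $S_{t_1-2,t_2,t_3}$-forcer for $G$.
   Context: For integers $t_1\ge0$, $t_2,t_3\ge1$, $S_{t_1,t_2,t_3}$ consists of a vertex $v$ and three paths of lengths $t_1,t_2,t_3$ (length = number of edges), each with one end $v$, whose vertex sets minus $v$ are pairwise disjoint and anticomplete. $H_1+H_2$ is the disjoint union of $H_1$ and $H_2$. $N[Z]$ is the closed neighbourhood of $Z$. For disjoint $X',Y\subseteq V(G)$, $X'$ breaks $Y$ if for every connected component $D$ of $G\setminus N[X']$, $Y\not\subseteq N[D]$. A graph $F$ is an $X$-forcer for $G$ if for every $Y\subseteq V(G)$ inducing a graph isomorphic to $F$ there exists $X'\subset Y$ inducing a graph isomorphic to $X$ such that $X'$ breaks $Y\setminus X'$. -}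

module Defs where

open import Data.Nat using (ℕ; zero; suc)
open import Data.Fin using (Fin; toℕ)
open import Data.Unit using (⊤; tt)
open import Data.Empty using (⊥)
open import Data.Sum using (_⊎_; inj₁; inj₂)
open import Data.Product using (Σ; ∃; _×_; _,_)
open import Relation.Nullary using (¬_)
open import Relation.Binary.PropositionalEquality using (_≡_)
open import Function.Definitions using (Injective)

record Graph (V : Set) : Set₁ where
  field
    E      : V → V → Set
    sym    : ∀ {x y} → E x y → E y x
    irrefl : ∀ {x} → ¬ E x x
open Graph public

-- Induced embedding of F into G: injective map preserving adjacency and non-adjacency.
-- Its image is a vertex set Y ⊆ V(G) with G[Y] ≅ F.
record InducedCopy {U V : Set} (F : Graph U) (G : Graph V) : Set where
  field
    map       : U → V
    injective : Injective _≡_ _≡_ map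
    adj⇔      : ∀ x y → (E F x y → E G (map x) (map y)) × (E G (map x) (map y) → E F x y)
open InducedCopy public

Contains : {U V : Set} → Graph U → Graph V → Set
Contains F G = InducedCopy F G

Pred : Set → Set₁
Pred V = V → Set

N[_] : {V : Set} {G : Graph V} → Pred V → Pred V
N[_] {G = G} Z v = Z v ⊎ ∃ λ z → Z z × E G z v

data Reach {V : Set} (G : Graph V) (P : Pred V) : V → V → Set where
  here : ∀ {u} → P u → Reach G P u u
  step : ∀ {u w v} → P u → E G u w → Reach G P w v → Reach G P u v

Component : {V : Set} → Graph V → Pred V → V → Pred V
Component G P u v = Reach G P u v

-- X' breaks Y: for every component D of G \ N[X'], Y ⊄ N[D].
-- Every component of G \ N[X'] is Component G (complement of N[X']) u for some u ∉ N[X'].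
Breaks : {V : Set} → Graph V → Pred V → Pred V → Set
Breaks {V} G X' Y =
  ∀ (u : V) → ¬ N[_] {G = G} X' u →
    ¬ (∀ y → Y y → N[_] {G = G} (Component G (λ v → ¬ N[_] {G = G} X' v) u) y)

Forcer : {A B V : Set} → Graph A → Graph B → Graph V → Set
Forcer {V = V} F X G =
  ∀ (f : InducedCopy F G) →
    let Y : Pred V
        Y v = ∃ λ a → map f a ≡ v
    in Σ (InducedCopy X G) λ h →
         let X' : Pred V
             X' v = ∃ λ b → map h b ≡ v
         in (∀ v → X' v → Y v) ×
            Breaks G X' (λ v → Y v × ¬ X' v)

-- vertices of the spider: centre, or the (k+1)-th vertex (distance k+1 from centre) on leg a
data SV (t : Fin 3 → ℕ) : Set where
  centre : SV t
  leg    : (a : Fin 3) → Fin (t a) → SV t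

SOut : {t : Fin 3 → ℕ} → SV t → SV t → Set
SOut centre centre = ⊥
SOut centre (leg a k) = toℕ k ≡ 0
SOut (leg a k) centre = ⊥
SOut (leg a k) (leg b l) = Σ (a ≡ b) λ _ → toℕ l ≡ suc (toℕ k)

private
  SOut-irr : {t : Fin 3 → ℕ} (x : SV t) → ¬ SOut x x
  SOut-irr centre ()
  SOut-irr (leg a k) (_ , p) = lemma (toℕ k) p
    where
      lemma : ∀ n → ¬ n ≡ suc n
      lemma n ()

  S-irr : {t : Fin 3 → ℕ} {x : SV t} → ¬ (SOut x x ⊎ SOut x x)
  S-irr {x = x} (inj₁ p) = SOut-irr x p
  S-irr {x = x} (inj₂ p) = SOut-irr x p

  swap : {A B : Set} → A ⊎ B → B ⊎ A
  swap (inj₁ a) = inj₂ a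
  swap (inj₂ b) = inj₁ b

legs : ℕ → ℕ → ℕ → Fin 3 → ℕ
legs t₁ t₂ t₃ Fin.zero = t₁
legs t₁ t₂ t₃ (Fin.suc Fin.zero) = t₂
legs t₁ t₂ t₃ (Fin.suc (Fin.suc Fin.zero)) = t₃

S : (t₁ t₂ t₃ : ℕ) → Graph (SV (legs t₁ t₂ t₃))
S t₁ t₂ t₃ = record
  { E = λ x y → SOut x y ⊎ SOut y x
  ; sym = swap
  ; irrefl = S-irr
  }

K₁ : Graph ⊤
K₁ = record { E = λ _ _ → ⊥ ; sym = λ () ; irrefl = λ () }

DUE : {A B : Set} → Graph A → Graph B → A ⊎ B → A ⊎ B → Set
DUE H₁ H₂ (inj₁ x) (inj₁ y) = E H₁ x y
DUE H₁ H₂ (inj₁ x) (inj₂ y) = ⊥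
DUE H₁ H₂ (inj₂ x) (inj₁ y) = ⊥
DUE H₁ H₂ (inj₂ x) (inj₂ y) = E H₂ x y

_+ᴳ_ : {A B : Set} → Graph A → Graph B → Graph (A ⊎ B)
H₁ +ᴳ H₂ = record { E = DUE H₁ H₂ ; sym = λ {x} {y} → s {x} {y} ; irrefl = λ {x} → i {x} }
  where
    s : ∀ {x y} → DUE H₁ H₂ x y → DUE H₁ H₂ y x
    s {inj₁ x} {inj₁ y} e = sym H₁ e
    s {inj₂ x} {inj₂ y} e = sym H₂ e
    i : ∀ {x} → ¬ DUE H₁ H₂ x x
    i {inj₁ x} = irrefl H₁
    i {inj₂ x} = irrefl H₂

-- Let Y ⊆ V(G) induce S_{t₁-1,t₂,t₃} + K₁ and let X' ⊆ Y be the copy of S_{t₁-2,t₂,t₃}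
-- obtained by deleting the end a of the first leg. Then a ∈ N[X'], so a lies in no
-- component D of G \ N[X']; if a had a neighbour d ∈ D, then d ∉ N[X'] and appending d
-- to the first leg would give an induced S_{t₁,t₂,t₃}. Hence a ∉ N[D] for every D.
module Submission where

open import Defs
open import Data.Nat using (ℕ; zero; suc; _≤_; _<_; _∸_; s≤s; z≤n)
open import Data.Nat.Properties using (<-asym; n<1+n; suc-injective)
open import Data.Fin using (Fin; toℕ; fromℕ; inject₁) renaming (zero to fz; suc to fs)
open import Data.Fin.Properties using (toℕ-injective; toℕ<n; toℕ-fromℕ; toℕ-inject₁; fromℕ≢inject₁)
open import Data.Empty using (⊥; ⊥-elim)
open import Data.Sum using (_⊎_; inj₁; inj₂; [_,_])
open import Data.Sum.Properties using (inj₁-injective)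
open import Data.Product using (Σ; ∃; _×_; _,_; proj₁; proj₂)
open import Function using (id; _∘_)
open import Function.Bundles using (_⇔_; mk⇔; Equivalence)
open import Function.Construct.Composition using (_⇔-∘_)
open import Relation.Nullary using (¬_)
open import Relation.Binary.PropositionalEquality
  using (_≡_; _≢_; refl; cong; cong₂; subst; trans; module ≡-Reasoning)
  renaming (sym to ≡-sym)

open Equivalence using (to; from)

Image : {A V : Set} → (A → V) → Pred V
Image g v = ∃ λ a → g a ≡ v

reach-end : {V : Set} {G : Graph V} {P : Pred V} {u v : V} → Reach G P u v → P v
reach-end (here p) = p
reach-end (step _ _ r) = reach-end r

module _ {A B V : Set} {K : Graph A} {H : Graph B} {G : Graph V} where

  _∘ᶜ_ : InducedCopy H G → InducedCopy K H → InducedCopy K G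
  F ∘ᶜ ι = record
    { map       = map F ∘ map ι
    ; injective = injective ι ∘ injective F
    ; adj⇔      = λ x y →
        (proj₁ (adj⇔ F _ _) ∘ proj₁ (adj⇔ ι x y)) ,
        (proj₂ (adj⇔ ι x y) ∘ proj₂ (adj⇔ F _ _))
    }

inj₁-copy : {A B : Set} {H₁ : Graph A} {H₂ : Graph B} → InducedCopy H₁ (H₁ +ᴳ H₂)
inj₁-copy = record { map = inj₁ ; injective = inj₁-injective ; adj⇔ = λ _ _ → id , id }

-- The hypotheses say that H is K plus one vertex p.
module _ {A B V : Set} {K : Graph A} {H : Graph B} {G : Graph V}
         (ι : InducedCopy K H) (p : B)
         (p-or-ι : ∀ b → b ≡ p ⊎ ∃ λ a → b ≡ map ι a)
         (ι≢p : ∀ a → map ι a ≢ p) where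

  extend-copy : (F : InducedCopy K G) (d : V) → (∀ a → d ≢ map F a) →
                (∀ a → E H p (map ι a) ⇔ E G d (map F a)) → InducedCopy H G
  extend-copy F d d∉F p-adj = record { map = g ; injective = g-injective ; adj⇔ = g-adj }
    where
    g : B → V
    g b = [ (λ _ → d) , (λ (a , _) → map F a) ] (p-or-ι b)

    g-p : g p ≡ d
    g-p with p-or-ι p
    ... | inj₁ _ = refl
    ... | inj₂ (a , p≡ιa) = ⊥-elim (ι≢p a (≡-sym p≡ιa))

    g-ι : ∀ a → g (map ι a) ≡ map F a
    g-ι a with p-or-ι (map ι a)
    ... | inj₁ ιa≡p = ⊥-elim (ι≢p a ιa≡p)
    ... | inj₂ (a′ , ιa≡ιa′) = cong (map F) (injective ι (≡-sym ιa≡ιa′))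

    Split : B → Set
    Split b = b ≡ p ⊎ ∃ λ a → b ≡ map ι a

    injective-by-cases : ∀ {b c} → Split b → Split c → g b ≡ g c → b ≡ c
    injective-by-cases (inj₁ refl) (inj₁ refl) _ = refl
    injective-by-cases (inj₁ refl) (inj₂ (a , refl)) gp≡gιa =
      ⊥-elim (d∉F a (trans (≡-sym g-p) (trans gp≡gιa (g-ι a))))
    injective-by-cases (inj₂ (a , refl)) (inj₁ refl) gιa≡gp =
      ⊥-elim (d∉F a (trans (≡-sym g-p) (trans (≡-sym gιa≡gp) (g-ι a))))
    injective-by-cases (inj₂ (a , refl)) (inj₂ (a′ , refl)) gιa≡gιa′ =
      cong (map ι) (injective F (trans (≡-sym (g-ι a)) (trans gιa≡gιa′ (g-ι a′))))

    g-injective : ∀ {b c} → g b ≡ g c → b ≡ c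
    g-injective {b} {c} = injective-by-cases (p-or-ι b) (p-or-ι c)

    p-adj′ : ∀ a → E H p (map ι a) ⇔ E G (g p) (g (map ι a))
    p-adj′ a rewrite g-p | g-ι a = p-adj a

    ι-adj′ : ∀ a a′ → E H (map ι a) (map ι a′) ⇔ E G (g (map ι a)) (g (map ι a′))
    ι-adj′ a a′ rewrite g-ι a | g-ι a′ =
      mk⇔ (proj₁ (adj⇔ F a a′) ∘ proj₂ (adj⇔ ι a a′))
          (proj₁ (adj⇔ ι a a′) ∘ proj₂ (adj⇔ F a a′))

    adj-by-cases : ∀ {b c} → Split b → Split c → E H b c ⇔ E G (g b) (g c)
    adj-by-cases (inj₁ refl) (inj₁ refl) = mk⇔ (⊥-elim ∘ irrefl H) (⊥-elim ∘ irrefl G)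
    adj-by-cases (inj₁ refl) (inj₂ (a , refl)) = p-adj′ a
    adj-by-cases (inj₂ (a , refl)) (inj₁ refl) =
      mk⇔ (sym G ∘ to (p-adj′ a) ∘ sym H) (sym H ∘ from (p-adj′ a) ∘ sym G)
    adj-by-cases (inj₂ (a , refl)) (inj₂ (a′ , refl)) = ι-adj′ a a′

    g-adj : ∀ b c → (E H b c → E G (g b) (g c)) × (E G (g b) (g c) → E H b c)
    g-adj b c = to (adj-by-cases (p-or-ι b) (p-or-ι c)) ,
                from (adj-by-cases (p-or-ι b) (p-or-ι c))

fromℕ-or-inject₁ : ∀ {n} (i : Fin (suc n)) → i ≡ fromℕ n ⊎ ∃ λ j → i ≡ inject₁ j
fromℕ-or-inject₁ {zero}  fz     = inj₁ refl
fromℕ-or-inject₁ {suc n} fz     = inj₂ (fz , refl)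
fromℕ-or-inject₁ {suc n} (fs i) with fromℕ-or-inject₁ i
... | inj₁ i≡n        = inj₁ (cong fs i≡n)
... | inj₂ (j , i≡j) = inj₂ (fs j , cong fs i≡j)

-- Adjacency in a spider depends only on the leg and the index of each vertex, not on the
-- leg lengths; this is what makes lengthening a leg an induced embedding.
data Position : Set where
  hub : Position
  at  : Fin 3 → ℕ → Position

Outward : Position → Position → Set
Outward hub      hub      = ⊥
Outward hub      (at a k) = k ≡ 0
Outward (at a k) hub      = ⊥
Outward (at a k) (at b l) = Σ (a ≡ b) λ _ → l ≡ suc k

Adjacent : Position → Position → Set
Adjacent x y = Outward x y ⊎ Outward y x

at-injective : ∀ {a b k l} → at a k ≡ at b l → a ≡ b × k ≡ l
at-injective refl = refl , refl

position : {t : Fin 3 → ℕ} → SV t → Position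
position centre    = hub
position (leg a k) = at a (toℕ k)

position-injective : {t : Fin 3 → ℕ} {x y : SV t} → position x ≡ position y → x ≡ y
position-injective {x = centre}  {centre}  _ = refl
position-injective {x = leg a k} {leg b l} p with at-injective p
... | refl , k≡l = cong (leg a) (toℕ-injective k≡l)

E-S-position : ∀ {t₁ t₂ t₃} (x y : SV (legs t₁ t₂ t₃)) →
               E (S t₁ t₂ t₃) x y ≡ Adjacent (position x) (position y)
E-S-position centre    centre    = refl
E-S-position centre    (leg b l) = refl
E-S-position (leg a k) centre    = refl
E-S-position (leg a k) (leg b l) = refl

leg-injective : {t : Fin 3 → ℕ} {a : Fin 3} {k l : Fin (t a)} → leg {t} a k ≡ leg a l → k ≡ l
leg-injective refl = refl

module Spider (t₂ t₃ : ℕ) where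

  Vertex : ℕ → Set
  Vertex n = SV (legs n t₂ t₃)

  Spider : (n : ℕ) → Graph (Vertex n)
  Spider n = S n t₂ t₃

  lengthen : ∀ {n} → Vertex n → Vertex (suc n)
  lengthen centre               = centre
  lengthen (leg fz k)           = leg fz (inject₁ k)
  lengthen (leg (fs fz) k)      = leg (fs fz) k
  lengthen (leg (fs (fs fz)) k) = leg (fs (fs fz)) k

  position-lengthen : ∀ {n} (x : Vertex n) → position (lengthen x) ≡ position x
  position-lengthen centre               = refl
  position-lengthen (leg fz k)           = cong (at fz) (toℕ-inject₁ k)
  position-lengthen (leg (fs fz) k)      = refl
  position-lengthen (leg (fs (fs fz)) k) = refl

  E-lengthen : ∀ {n} (x y : Vertex n) →
               E (Spider (suc n)) (lengthen x) (lengthen y) ≡ E (Spider n) x y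
  E-lengthen x y = begin
    E (Spider _) (lengthen x) (lengthen y)               ≡⟨ E-S-position (lengthen x) (lengthen y) ⟩
    Adjacent (position (lengthen x)) (position (lengthen y))
      ≡⟨ cong₂ Adjacent (position-lengthen x) (position-lengthen y) ⟩
    Adjacent (position x) (position y)                   ≡⟨ ≡-sym (E-S-position x y) ⟩
    E (Spider _) x y                                     ∎
    where open ≡-Reasoning

  lengthen-copy : ∀ {n} → InducedCopy (Spider n) (Spider (suc n))
  lengthen-copy = record
    { map       = lengthen
    ; injective = λ {x} {y} lx≡ly → position-injective
        (trans (≡-sym (position-lengthen x)) (trans (cong position lx≡ly) (position-lengthen y)))
    ; adj⇔      = λ x y → subst id (≡-sym (E-lengthen x y)) , subst id (E-lengthen x y)
    }

  tip : ∀ n → Vertex (suc n)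
  tip n = leg fz (fromℕ n)

  beforeTip : ∀ n → Vertex n
  beforeTip zero    = centre
  beforeTip (suc n) = tip n

  tip-or-lengthen : ∀ {n} (x : Vertex (suc n)) → x ≡ tip n ⊎ ∃ λ y → x ≡ lengthen y
  tip-or-lengthen centre = inj₂ (centre , refl)
  tip-or-lengthen (leg fz k) with fromℕ-or-inject₁ k
  ... | inj₁ k≡n        = inj₁ (cong (leg fz) k≡n)
  ... | inj₂ (j , k≡j) = inj₂ (leg fz j , cong (leg fz) k≡j)
  tip-or-lengthen (leg (fs fz) k)      = inj₂ (leg (fs fz) k , refl)
  tip-or-lengthen (leg (fs (fs fz)) k) = inj₂ (leg (fs (fs fz)) k , refl)

  lengthen≢tip : ∀ {n} (x : Vertex n) → lengthen x ≢ tip n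
  lengthen≢tip centre               ()
  lengthen≢tip (leg fz k)           eq = fromℕ≢inject₁ (≡-sym (leg-injective eq))
  lengthen≢tip (leg (fs fz) k)      ()
  lengthen≢tip (leg (fs (fs fz)) k) ()

  adjacent-end→beforeTip : ∀ n (y : Vertex n) → Adjacent (at fz n) (position y) → y ≡ beforeTip n
  adjacent-end→beforeTip zero    centre     _                   = refl
  adjacent-end→beforeTip (suc n) centre     (inj₂ ())
  adjacent-end→beforeTip n       (leg fz k) (inj₁ (_ , k≡1+n)) =
    ⊥-elim (<-asym (n<1+n n) (subst (_< n) k≡1+n (toℕ<n k)))
  adjacent-end→beforeTip (suc n) (leg fz k) (inj₂ (_ , 1+n≡1+k)) =
    cong (leg fz) (toℕ-injective (trans (suc-injective (≡-sym 1+n≡1+k)) (≡-sym (toℕ-fromℕ n))))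
  adjacent-end→beforeTip n (leg (fs _) k) (inj₁ (() , _))
  adjacent-end→beforeTip n (leg (fs _) k) (inj₂ (() , _))

  beforeTip-adjacent-end : ∀ n → Adjacent (at fz n) (position (beforeTip n))
  beforeTip-adjacent-end zero    = inj₂ refl
  beforeTip-adjacent-end (suc n) = inj₂ (refl , cong suc (≡-sym (toℕ-fromℕ n)))

  tip-adjacent : ∀ n (y : Vertex n) → E (Spider (suc n)) (tip n) (lengthen y) ⇔ y ≡ beforeTip n
  tip-adjacent n y = mk⇔
    (adjacent-end→beforeTip n y ∘ subst id E≡)
    (λ { refl → subst id (≡-sym E≡) (beforeTip-adjacent-end n) })
    where
    E≡ : E (Spider (suc n)) (tip n) (lengthen y) ≡ Adjacent (at fz n) (position y)
    E≡ = trans (E-S-position (tip n) (lengthen y))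
               (cong₂ Adjacent (cong (at fz) (toℕ-fromℕ n)) (position-lengthen y))

  module _ {V : Set} {G : Graph V} {n : ℕ} (F : InducedCopy (Spider (suc n)) G) where

    Body : Pred V
    Body = Image (map F ∘ lengthen)

    tip-near-body : N[_] {G = G} Body (map F (tip n))
    tip-near-body = inj₂ (map F (lengthen (beforeTip n)) , (beforeTip n , refl) ,
      proj₁ (adj⇔ F _ _) (sym (Spider (suc n)) (from (tip-adjacent n (beforeTip n)) refl)))

    extend-first-leg : (d : V) → E G (map F (tip n)) d → ¬ N[_] {G = G} Body d →
                       Contains (Spider (suc (suc n))) G
    extend-first-leg d tip~d d∉N[Body] =
      extend-copy lengthen-copy (tip (suc n)) tip-or-lengthen lengthen≢tip F d d∉F adjacent
      where
      d∉F : ∀ x → d ≢ map F x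
      d∉F x d≡Fx with tip-or-lengthen x
      ... | inj₁ refl         = irrefl G (subst (E G (map F (tip n))) d≡Fx tip~d)
      ... | inj₂ (y , refl) = d∉N[Body] (inj₁ (y , ≡-sym d≡Fx))

      d~F⇔tip : ∀ x → x ≡ tip n ⇔ E G d (map F x)
      d~F⇔tip x = mk⇔ (λ { refl → sym G tip~d }) (λ d~Fx → case-split (tip-or-lengthen x) d~Fx)
        where
        case-split : x ≡ tip n ⊎ (∃ λ y → x ≡ lengthen y) → E G d (map F x) → x ≡ tip n
        case-split (inj₁ x≡tip)        _    = x≡tip
        case-split (inj₂ (y , refl)) d~Fx = ⊥-elim (d∉N[Body] (inj₂ (_ , (y , refl) , sym G d~Fx)))

      adjacent : ∀ x → E (Spider (suc (suc n))) (tip (suc n)) (lengthen x) ⇔ E G d (map F x)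
      adjacent x = d~F⇔tip x ⇔-∘ tip-adjacent (suc n) x

open Spider

lemma4p1 : (t₁ t₂ t₃ : ℕ) → 2 ≤ t₁ → 1 ≤ t₂ → 1 ≤ t₃ →
    (n : ℕ) (G : Graph (Fin n)) →
    ¬ Contains (S t₁ t₂ t₃) G →
    Forcer (S (t₁ ∸ 1) t₂ t₃ +ᴳ K₁) (S (t₁ ∸ 2) t₂ t₃) G
lemma4p1 (suc (suc s)) t₂ t₃ (s≤s (s≤s z≤n)) _ _ n G no-S f =
  spider ∘ᶜ lengthen-copy t₂ t₃ , (λ { _ (b , eq) → inj₁ (lengthen t₂ t₃ b) , eq }) , breaks
  where
  spider : InducedCopy (Spider t₂ t₃ (suc s)) G
  spider = f ∘ᶜ inj₁-copy

  end : Fin n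
  end = map spider (tip t₂ t₃ s)

  end∉body : ¬ Body t₂ t₃ spider end
  end∉body (b , eq) = lengthen≢tip t₂ t₃ b (injective spider eq)

  breaks : Breaks G (Body t₂ t₃ spider) (λ v → Image (map f) v × ¬ Body t₂ t₃ spider v)
  breaks u _ covers with covers end ((inj₁ (tip t₂ t₃ s) , refl) , end∉body)
  ... | inj₁ end∈D             = reach-end end∈D (tip-near-body t₂ t₃ spider)
  ... | inj₂ (d , d∈D , d~end) =
    no-S (extend-first-leg t₂ t₃ spider d (sym G d~end) (reach-end d∈D))
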